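{- Let $T$ be a balanced tree of height 3. Suppose that (1) for all $u\in V_2$, $|N(u)\cap V_1|=1$, and (2) for all $s\in V_1$, $|N(s)\cap V_2|\le 1$. Then $T$ is well-totally dominated.
   Context: All graphs are finite and simple. $N(v)$ is the open neighborhood of $v$. A leaf is a vertex of degree 1; the height of a vertex is its minimum distance to a leaf; $V_k$ is the set of vertices of height $k$; the height of $T$ is the maximum height of a vertex. A tree is balanced if no two vertices of the same height are adjacent. A total dominating set is a set $S$ with $N(S)=V(T)$, where $N(S)=\bigcup_{v\in S}N(v)$; $T$ is well-totally dominated if all its inclusion-minimal total dominating sets have the same size. -}

module Defs where

open import Data.Nat using (ℕ; zero; suc; _≤_)
open import Data.Fin using (Fin)
open import Data.Fin.Subset using (Subset; _∈_; _⊆_; ∣_∣)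
open import Data.Bool using (Bool; T)
open import Data.List using (List; _∷_; []; _++_; [_]; length)
open import Data.List.Relation.Unary.Linked using (Linked)
open import Data.List.Relation.Unary.Unique.Propositional using (Unique)
open import Data.Product using (Σ; _×_; ∃; ∃-syntax)
open import Relation.Binary.PropositionalEquality using (_≡_)
open import Relation.Nullary using (¬_)
open import Data.Empty using (⊥)

record Graph (n : ℕ) : Set where
  field
    adj    : Fin n → Fin n → Bool
    sym    : ∀ u v → adj u v ≡ adj v u
    irrefl : ∀ v → ¬ T (adj v v)

module _ {n : ℕ} (G : Graph n) where
  open Graph G

  Adj : Fin n → Fin n → Set
  Adj u v = T (adj u v)

  data Walk : Fin n → Fin n → ℕ → Set where
    here : ∀ {v} → Walk v v zero
    step : ∀ {u w v d} → Adj u w → Walk w v d → Walk u v (suc d)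

  Connected : Set
  Connected = ∀ u v → ∃[ d ] Walk u v d

  Cycle : Fin n → List (Fin n) → Set
  Cycle v₀ xs = Unique (v₀ ∷ xs) × Linked Adj (v₀ ∷ xs ++ [ v₀ ]) × (2 ≤ length xs)

  Acyclic : Set
  Acyclic = ∀ v₀ xs → ¬ Cycle v₀ xs

  IsTree : Set
  IsTree = Connected × Acyclic

  Leaf : Fin n → Set
  Leaf v = ∃[ w ] (Adj v w × (∀ w′ → Adj v w′ → w′ ≡ w))

  -- Height v k : the minimum distance from v to a leaf is k  (v ∈ V_k)
  Height : Fin n → ℕ → Set
  Height v k = (∃[ ℓ ] (Leaf ℓ × Walk v ℓ k))
             × (∀ ℓ d → Leaf ℓ → Walk v ℓ d → k ≤ d)

  GraphHeight : ℕ → Set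
  GraphHeight h = (∃[ v ] Height v h) × (∀ v k → Height v k → k ≤ h)

  Balanced : Set
  Balanced = ∀ u v k → Adj u v → Height u k → Height v k → ⊥

  TotalDominating : Subset n → Set
  TotalDominating S = ∀ v → ∃[ u ] (u ∈ S × Adj u v)

  MinimalTotalDominating : Subset n → Set
  MinimalTotalDominating S =
    TotalDominating S × (∀ S′ → S′ ⊆ S → TotalDominating S′ → S ⊆ S′)

  WellTotallyDominated : Set
  WellTotallyDominated =
    ∀ S S′ → MinimalTotalDominating S → MinimalTotalDominating S′ → ∣ S ∣ ≡ ∣ S′ ∣

{-# OPTIONS --safe #-}
-- Every vertex of V₁ supports a leaf, so it lies in every total dominating set S. If S is
-- minimal, no vertex of V₃ lies in S (its neighbours are in V₂ and are already dominated by
-- their V₁-neighbour, by (1)), and each s ∈ V₁ has exactly one neighbour in S: the neighbours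
-- of s lie in V₀ ∪ V₂, two in V₂ are excluded by (2), and a leaf in S sharing s with another
-- vertex of S would be redundant. A vertex of V₀ ∪ V₂ has a unique V₁-neighbour. So for two
-- minimal total dominating sets S and S′, sending x ∈ S to itself if x ∈ V₁ and otherwise to
-- the S′-neighbour of its V₁-neighbour is injective, so |S| ≤ |S′| and by symmetry |S| = |S′|.
module Submission where

open import Defs
open import Data.Nat using (ℕ; zero; suc; _≤_; _<_; z≤n; s≤s)
open import Data.Nat.Properties using (≤-antisym; ≤-pred; ≮⇒≥; ≤∧≢⇒<; anyUpTo?; module ≤-Reasoning)
open import Data.Nat.Induction using (<-rec)
open import Data.Fin using (Fin; zero; suc; _≟_)
open import Data.Fin.Properties using (any?; all?)
open import Data.Fin.Subset using (Subset; _∈_; _∉_; _⊂_; ∣_∣; _-_; ⁅_⁆; inside; outside; Empty)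
open import Data.Fin.Subset.Properties
  using (nonempty?; Empty-unique; ∣⊥∣≡0; p─⊥≡p; p─q⊆p; x∈p∧x≢y⇒x∈p-y; x∈p⇒p-x⊂p)
open import Data.Fin.Subset.Induction using (⊂-wellFounded; Acc; acc)
open import Data.Vec.Base using (_∷_; here; there)
open import Data.Bool using (T)
open import Data.Empty using (⊥-elim)
open import Data.Product using (_×_; _,_; proj₁; proj₂; ∃; ∃-syntax)
open import Data.Sum using (_⊎_; inj₁; inj₂)
open import Function using (_∘_; case_of_)
open import Relation.Binary.PropositionalEquality using (_≡_; _≢_; refl; sym; trans; cong; subst)
open import Relation.Nullary using (¬_; Dec; yes; no)
open import Relation.Nullary.Decidable using (T?; _×-dec_; _→-dec_)
open import Relation.Unary using (Decidable)

∃-least : ∀ {P : ℕ → Set} → Decidable P → ∀ {d} → P d → ∃[ k ] (P k × (∀ {j} → P j → k ≤ j))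
∃-least {P} P? {d} = <-rec (λ d → P d → Least) search d
  where
  Least : Set
  Least = ∃[ k ] (P k × (∀ {j} → P j → k ≤ j))

  search : ∀ d → (∀ {j} → j < d → P j → Least) → P d → Least
  search d below Pd with anyUpTo? P? d
  ... | yes (j , j<d , Pj) = below j<d Pj
  ... | no none = d , Pd , λ Pj → ≮⇒≥ λ j<d → none (_ , j<d , Pj)

x∉p-x : ∀ {n} (p : Subset n) (x : Fin n) → x ∉ p - x
x∉p-x (_ ∷ p) zero    ()
x∉p-x (_ ∷ p) (suc x) (there x∈p-x) = x∉p-x p x x∈p-x

∣p∣≡1+∣p-x∣ : ∀ {n} {p : Subset n} {x} → x ∈ p → ∣ p ∣ ≡ suc ∣ p - x ∣
∣p∣≡1+∣p-x∣ {p = inside  ∷ p} here        = cong (suc ∘ ∣_∣) (sym (p─⊥≡p p))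
∣p∣≡1+∣p-x∣ {p = inside  ∷ p} (there x∈p) = cong suc (∣p∣≡1+∣p-x∣ x∈p)
∣p∣≡1+∣p-x∣ {p = outside ∷ p} (there x∈p) = ∣p∣≡1+∣p-x∣ x∈p

Empty⇒∣p∣≡0 : ∀ {n} {p : Subset n} → Empty p → ∣ p ∣ ≡ 0
Empty⇒∣p∣≡0 {n} p-empty = trans (cong ∣_∣ (Empty-unique p-empty)) (∣⊥∣≡0 n)

module _ {n : ℕ} (R : Fin n → Fin n → Set) where

  ∣p∣≤∣q∣-by-injective-relation : ∀ {p q : Subset n}
    → (∀ {x} → x ∈ p → ∃[ z ] (z ∈ q × R x z))
    → (∀ {x y z} → x ∈ p → y ∈ p → R x z → R y z → x ≡ y)
    → ∣ p ∣ ≤ ∣ q ∣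
  ∣p∣≤∣q∣-by-injective-relation = go (⊂-wellFounded _)
    where
    go : ∀ {p q} → Acc _⊂_ p
       → (∀ {x} → x ∈ p → ∃[ z ] (z ∈ q × R x z))
       → (∀ {x y z} → x ∈ p → y ∈ p → R x z → R y z → x ≡ y)
       → ∣ p ∣ ≤ ∣ q ∣
    go {p} {q} (acc smaller) total injective with nonempty? p
    ... | no p-empty = subst (_≤ ∣ q ∣) (sym (Empty⇒∣p∣≡0 p-empty)) z≤n
    ... | yes (x , x∈p) with total x∈p
    ...   | z , z∈q , xRz = begin
      ∣ p ∣          ≡⟨ ∣p∣≡1+∣p-x∣ x∈p ⟩
      suc ∣ p - x ∣  ≤⟨ s≤s (go (smaller (x∈p⇒p-x⊂p x∈p)) total′ injective′) ⟩
      suc ∣ q - z ∣  ≡⟨ sym (∣p∣≡1+∣p-x∣ z∈q) ⟩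
      ∣ q ∣          ∎
      where
      open ≤-Reasoning

      ⊆p : ∀ {y} → y ∈ p - x → y ∈ p
      ⊆p = p─q⊆p p ⁅ x ⁆

      total′ : ∀ {y} → y ∈ p - x → ∃[ z′ ] (z′ ∈ q - z × R y z′)
      total′ y∈p-x with total (⊆p y∈p-x)
      ... | z′ , z′∈q , yRz′ = z′ , x∈p∧x≢y⇒x∈p-y z′∈q z′≢z , yRz′
        where
        z′≢z : z′ ≢ z
        z′≢z refl = x∉p-x p x (subst (_∈ p - x) (injective (⊆p y∈p-x) x∈p yRz′ xRz) y∈p-x)

      injective′ : ∀ {y y′ z′} → y ∈ p - x → y′ ∈ p - x → R y z′ → R y′ z′ → y ≡ y′
      injective′ y∈p-x y′∈p-x = injective (⊆p y∈p-x) (⊆p y′∈p-x)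

module GraphProperties {n : ℕ} (G : Graph n) where

  Adj-sym : ∀ {u v} → Adj G u v → Adj G v u
  Adj-sym {u} {v} = subst T (Graph.sym G u v)

  Adj? : ∀ u v → Dec (Adj G u v)
  Adj? u v = T? (Graph.adj G u v)

  Leaf? : ∀ v → Dec (Leaf G v)
  Leaf? v = any? λ w → Adj? v w ×-dec all? λ w′ → Adj? v w′ →-dec w′ ≟ w

  leaf-adj-unique : ∀ {ℓ v v′} → Leaf G ℓ → Adj G ℓ v → Adj G ℓ v′ → v ≡ v′
  leaf-adj-unique (_ , _ , only) ℓv ℓv′ = trans (only _ ℓv) (sym (only _ ℓv′))

  WalkToLeaf : Fin n → ℕ → Set
  WalkToLeaf v k = ∃[ ℓ ] (Leaf G ℓ × Walk G v ℓ k)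

  walkToLeaf? : ∀ v k → Dec (WalkToLeaf v k)
  walkToLeaf? v zero with Leaf? v
  ... | yes leaf = yes (v , leaf , here)
  ... | no ¬leaf = no λ { (_ , leaf , here) → ¬leaf leaf }
  walkToLeaf? v (suc k) with any? (λ w → Adj? v w ×-dec walkToLeaf? w k)
  ... | yes (w , vw , ℓ , leaf , walk) = yes (ℓ , leaf , step vw walk)
  ... | no ¬step = no λ { (ℓ , leaf , step vw walk) → ¬step (_ , vw , ℓ , leaf , walk) }

  height-exists : Connected G → ∃ (Leaf G) → ∀ v → ∃ (Height G v)
  height-exists connected (ℓ , leaf) v with connected v ℓ
  ... | _ , walk with ∃-least (walkToLeaf? v) (ℓ , leaf , walk)
  ...   | k , reach , least = k , reach , λ ℓ′ _ leaf′ walk′ → least (ℓ′ , leaf′ , walk′)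

  height-unique : ∀ {v k k′} → Height G v k → Height G v k′ → k ≡ k′
  height-unique ((ℓ , leaf , walk) , least) ((ℓ′ , leaf′ , walk′) , least′) =
    ≤-antisym (least ℓ′ _ leaf′ walk′) (least′ ℓ _ leaf walk)

  adj-height-≤ : ∀ {u v a b} → Adj G u v → Height G u a → Height G v b → a ≤ suc b
  adj-height-≤ uv (_ , least) ((ℓ , leaf , walk) , _) = least ℓ _ leaf (step uv walk)

  leaf⇒height0 : ∀ {v} → Leaf G v → Height G v 0
  leaf⇒height0 {v} leaf = (v , leaf , here) , λ _ _ _ _ → z≤n

  height0⇒leaf : ∀ {v} → Height G v 0 → Leaf G v
  height0⇒leaf ((_ , leaf , here) , _) = leaf

  height1⇒adj-leaf : ∀ {s} → Height G s 1 → ∃[ ℓ ] (Leaf G ℓ × Adj G s ℓ)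
  height1⇒adj-leaf ((ℓ , leaf , step sℓ here) , _) = ℓ , leaf , sℓ

  Redundant : Subset n → Fin n → Set
  Redundant S x = ∀ v → Adj G x v → ∃[ u ] (u ∈ S × u ≢ x × Adj G u v)

  minimal⇒¬redundant : ∀ {S x} → MinimalTotalDominating G S → x ∈ S → ¬ Redundant S x
  minimal⇒¬redundant {S} {x} (dominating , minimal) x∈S redundant =
    x∉p-x S x (minimal (S - x) (p─q⊆p S ⁅ x ⁆) dominating-without-x x∈S)
    where
    dominating-without-x : TotalDominating G (S - x)
    dominating-without-x v with dominating v
    ... | u , u∈S , uv with u ≟ x
    ...   | no u≢x = u , x∈p∧x≢y⇒x∈p-y u∈S u≢x , uv
    ...   | yes refl with redundant v uv
    ...     | u′ , u′∈S , u′≢x , u′v = u′ , x∈p∧x≢y⇒x∈p-y u′∈S u′≢x , u′v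

  leaf-support∈ : ∀ {S ℓ s} → TotalDominating G S → Leaf G ℓ → Adj G ℓ s → s ∈ S
  leaf-support∈ {S} dominating leaf ℓs with dominating _
  ... | u , u∈S , uℓ = subst (_∈ S) (leaf-adj-unique leaf (Adj-sym uℓ) ℓs) u∈S

  V₁⊆S : ∀ {S s} → TotalDominating G S → Height G s 1 → s ∈ S
  V₁⊆S dominating s1 with _ , leaf , sℓ ← height1⇒adj-leaf s1 =
    leaf-support∈ dominating leaf (Adj-sym sℓ)

  leaf∈minimal-shares-no-neighbour : ∀ {S s x y} → MinimalTotalDominating G S
    → Leaf G x → x ∈ S → y ∈ S → Adj G s x → Adj G s y → x ≡ y
  leaf∈minimal-shares-no-neighbour {S} {x = x} {y} S-minimal leaf x∈S y∈S sx sy with y ≟ x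
  ... | yes y≡x = sym y≡x
  ... | no y≢x = ⊥-elim (minimal⇒¬redundant S-minimal x∈S redundant)
    where
    redundant : Redundant S x
    redundant v xv = y , y∈S , y≢x , subst (Adj G y) (leaf-adj-unique leaf (Adj-sym sx) xv) (Adj-sym sy)

  module BalancedHeights (balanced : Balanced G) (height : ∀ v → ∃ (Height G v)) where

    leaf-neighbour-height1 : ∀ {ℓ s} → Leaf G ℓ → Adj G ℓ s → Height G s 1
    leaf-neighbour-height1 {ℓ} {s} leaf ℓs with height s
    ... | zero , s0 = ⊥-elim (balanced ℓ s 0 ℓs (leaf⇒height0 leaf) s0)
    ... | suc zero , s1 = s1
    ... | suc (suc _) , s2+ with s≤s () ← adj-height-≤ (Adj-sym ℓs) s2+ (leaf⇒height0 leaf)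

    V₁-neighbour-height : ∀ {s v} → Height G s 1 → Adj G s v → Height G v 0 ⊎ Height G v 2
    V₁-neighbour-height {s} {v} s1 sv with height v
    ... | zero , v0 = inj₁ v0
    ... | suc zero , v1 = ⊥-elim (balanced s v 1 sv s1 v1)
    ... | suc (suc zero) , v2 = inj₂ v2
    ... | suc (suc (suc _)) , v3+ with s≤s (s≤s ()) ← adj-height-≤ (Adj-sym sv) v3+ s1

    top-neighbour-height : ∀ {h w v} → GraphHeight G (suc h)
      → Height G w (suc h) → Adj G w v → Height G v h
    top-neighbour-height {h} {w} {v} (_ , bounded) w-top wv with height v
    ... | k , vk = subst (Height G v) (≤-antisym k≤h h≤k) vk
      where
      k≢1+h : k ≢ suc h
      k≢1+h refl = balanced w v _ wv w-top vk
      k≤h : k ≤ h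
      k≤h = ≤-pred (≤∧≢⇒< (bounded v k vk) k≢1+h)
      h≤k : h ≤ k
      h≤k = ≤-pred (adj-height-≤ wv w-top vk)

  module HeightThree
    (connected : Connected G) (balanced : Balanced G) (height-3 : GraphHeight G 3)
    (V₂-unique-V₁-neighbour : ∀ u → Height G u 2 → ∃[ s ] ((Adj G u s × Height G s 1)
       × (∀ s′ → Adj G u s′ → Height G s′ 1 → s′ ≡ s)))
    (V₁-at-most-one-V₂-neighbour : ∀ s u u′ → Height G s 1 → Adj G s u → Height G u 2
       → Adj G s u′ → Height G u′ 2 → u ≡ u′)
    where

    height : ∀ v → ∃ (Height G v)
    height = height-exists connected (let ((_ , (ℓ , leaf , _) , _) , _) = height-3 in ℓ , leaf)

    open BalancedHeights balanced height

    V₁-neighbour : ∀ {x} → Height G x 0 ⊎ Height G x 2 → ∃[ s ] (Height G s 1 × Adj G x s)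
    V₁-neighbour (inj₁ x0) with w , xw , _ ← height0⇒leaf x0 =
      w , leaf-neighbour-height1 (height0⇒leaf x0) xw , xw
    V₁-neighbour (inj₂ x2) with s , (xs , s1) , _ ← V₂-unique-V₁-neighbour _ x2 = s , s1 , xs

    V₁-neighbour-unique : ∀ {x s s′} → Height G x 0 ⊎ Height G x 2
      → Height G s 1 → Adj G x s → Height G s′ 1 → Adj G x s′ → s ≡ s′
    V₁-neighbour-unique (inj₁ x0) _ xs _ xs′ = leaf-adj-unique (height0⇒leaf x0) xs xs′
    V₁-neighbour-unique (inj₂ x2) s1 xs s′1 xs′ with _ , _ , only ← V₂-unique-V₁-neighbour _ x2 =
      trans (only _ xs s1) (sym (only _ xs′ s′1))

    module _ {S : Subset n} (S-minimal : MinimalTotalDominating G S) where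

      V₃∩S≡∅ : ∀ {w} → Height G w 3 → w ∉ S
      V₃∩S≡∅ {w} w3 w∈S = minimal⇒¬redundant S-minimal w∈S redundant
        where
        redundant : Redundant S w
        redundant v wv
          with s , (vs , s1) , _ ← V₂-unique-V₁-neighbour v (top-neighbour-height height-3 w3 wv) =
          s , V₁⊆S (proj₁ S-minimal) s1 , (λ { refl → case height-unique s1 w3 of λ () }) , Adj-sym vs

      V₁-has-one-S-neighbour : ∀ {s x y} → Height G s 1
        → x ∈ S → y ∈ S → Adj G s x → Adj G s y → x ≡ y
      V₁-has-one-S-neighbour {s} {x} {y} s1 x∈S y∈S sx sy
        with V₁-neighbour-height s1 sx | V₁-neighbour-height s1 sy
      ... | inj₁ x0 | _ = leaf∈minimal-shares-no-neighbour S-minimal (height0⇒leaf x0) x∈S y∈S sx sy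
      ... | _ | inj₁ y0 = sym (leaf∈minimal-shares-no-neighbour S-minimal (height0⇒leaf y0) y∈S x∈S sy sx)
      ... | inj₂ x2 | inj₂ y2 = V₁-at-most-one-V₂-neighbour s x y s1 sx x2 sy y2

    Partners : Fin n → Fin n → Set
    Partners x z = x ≡ z ⊎ ∃[ s ] (Height G s 1 × Adj G x s × Adj G z s)

    partners-injective : ∀ {S x y z} → MinimalTotalDominating G S
      → x ∈ S → y ∈ S → Partners x z → Partners y z → x ≡ y
    partners-injective _ _ _ (inj₁ refl) (inj₁ refl) = refl
    partners-injective S-minimal x∈S y∈S (inj₁ refl) (inj₂ (s , s1 , ys , xs)) =
      V₁-has-one-S-neighbour S-minimal s1 x∈S y∈S (Adj-sym xs) (Adj-sym ys)
    partners-injective S-minimal x∈S y∈S (inj₂ (s , s1 , xs , ys)) (inj₁ refl) =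
      V₁-has-one-S-neighbour S-minimal s1 x∈S y∈S (Adj-sym xs) (Adj-sym ys)
    partners-injective {y = y} S-minimal x∈S y∈S (inj₂ (s , s1 , xs , zs)) (inj₂ (s′ , s′1 , ys , zs′)) =
      V₁-has-one-S-neighbour S-minimal s1 x∈S y∈S (Adj-sym xs) (Adj-sym (subst (Adj G y) (sym s≡s′) ys))
      where
      s≡s′ : s ≡ s′
      s≡s′ = V₁-neighbour-unique (V₁-neighbour-height s1 (Adj-sym zs)) s1 zs s′1 zs′

    V₀∪V₂-partner : ∀ {S x} → TotalDominating G S
      → Height G x 0 ⊎ Height G x 2 → ∃[ z ] (z ∈ S × Partners x z)
    V₀∪V₂-partner dominating x02 with s , s1 , xs ← V₁-neighbour x02 =
      let z , z∈S , zs = dominating s in z , z∈S , inj₂ (s , s1 , xs , zs)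

    partner-in : ∀ {S S′ x} → MinimalTotalDominating G S → MinimalTotalDominating G S′
      → x ∈ S → ∃[ z ] (z ∈ S′ × Partners x z)
    partner-in {x = x} S-minimal S′-minimal x∈S with height x
    ... | 0 , x0 = V₀∪V₂-partner (proj₁ S′-minimal) (inj₁ x0)
    ... | 1 , x1 = x , V₁⊆S (proj₁ S′-minimal) x1 , inj₁ refl
    ... | 2 , x2 = V₀∪V₂-partner (proj₁ S′-minimal) (inj₂ x2)
    ... | 3 , x3 = ⊥-elim (V₃∩S≡∅ S-minimal x3 x∈S)
    ... | suc (suc (suc (suc _))) , x4+ with s≤s (s≤s (s≤s ())) ← proj₂ height-3 x _ x4+

    ∣S∣≤∣S′∣ : ∀ {S S′} → MinimalTotalDominating G S → MinimalTotalDominating G S′ → ∣ S ∣ ≤ ∣ S′ ∣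
    ∣S∣≤∣S′∣ S-minimal S′-minimal =
      ∣p∣≤∣q∣-by-injective-relation Partners
        (partner-in S-minimal S′-minimal) (partners-injective S-minimal)

theorem4p12 : ∀ {n} (T : Graph n) → IsTree T → Balanced T → GraphHeight T 3
    → (∀ u → Height T u 2 → ∃[ s ] ((Adj T u s × Height T s 1)
         × (∀ s′ → Adj T u s′ → Height T s′ 1 → s′ ≡ s)))
    → (∀ s u u′ → Height T s 1 → Adj T s u → Height T u 2 → Adj T s u′ → Height T u′ 2 → u ≡ u′)
    → WellTotallyDominated T
theorem4p12 T (connected , _) balanced height-3 condition-1 condition-2 S S′ S-minimal S′-minimal =
  ≤-antisym (∣S∣≤∣S′∣ S-minimal S′-minimal) (∣S∣≤∣S′∣ S′-minimal S-minimal)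
  where open GraphProperties.HeightThree T connected balanced height-3 condition-1 condition-2
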